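{- Let $G$ be a connected graph with maximum degree $\Delta$ and minimum degree $\delta$. Then $$\frac{SO(G)}{2\Delta}\leq DSO(G) \leq \frac{SO(G)}{2\delta}.$$ Equality holds if and only if $G$ is a regular graph.
   Context: For a simple graph $G=(V,E)$, $d_u$ denotes the degree of vertex $u$. The Diminished Sombor index is $DSO(G)=\sum_{uv\in E}\frac{\sqrt{d_u^2+d_v^2}}{d_u+d_v}$, and the Sombor index is $SO(G)=\sum_{uv\in E}\sqrt{d_u^2+d_v^2}$. -}

module Defs where

open import Level using (Level; _⊔_) renaming (suc to lsuc)
open import Data.Nat as ℕ using (ℕ; zero; suc; _⊓_) renaming (_⊔_ to _⊔ℕ_; _<_ to _<ℕ_)
open import Data.Bool using (Bool; true; false; if_then_else_)
open import Data.Fin using (Fin; toℕ) renaming (zero to fzero)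
open import Data.List using (List; []; _∷_; map; foldr; filter; length)
open import Data.List.Base using (allFin)
open import Data.Product using (_×_; Σ)
open import Relation.Nullary using (¬_)
open import Relation.Binary.PropositionalEquality using (_≡_)
open import Relation.Binary.Structures using (IsTotalOrder)
open import Algebra.Bundles using (CommutativeRing)

record Graph (n : ℕ) : Set where
  field
    adj     : Fin n → Fin n → Bool
    sym     : ∀ i j → adj i j ≡ adj j i
    irrefl  : ∀ i → adj i i ≡ false
open Graph public

deg : ∀ {n} → Graph n → Fin n → ℕ
deg {n} G i = length (filter (λ j → adj G i j Data.Bool.≟ true) (allFin n))
  where import Data.Bool

data Reach {n} (G : Graph n) : Fin n → Fin n → Set where
  here : ∀ {i} → Reach G i i
  step : ∀ {i j k} → adj G i j ≡ true → Reach G j k → Reach G i k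

Connected : ∀ {n} → Graph n → Set
Connected G = ∀ i j → Reach G i j

maxDeg : ∀ {m} → Graph (suc m) → ℕ
maxDeg {m} G = foldr _⊔ℕ_ 0 (map (deg G) (allFin (suc m)))

minDeg : ∀ {m} → Graph (suc m) → ℕ
minDeg {m} G = foldr _⊓_ (deg G fzero) (map (deg G) (allFin (suc m)))

Regular : ∀ {n} → Graph n → Set
Regular G = ∀ i j → deg G i ≡ deg G j

-- An ordered field equipped with a square-root function
-- (the real numbers are the intended model)

record SqrtOrderedField (c ℓ₁ ℓ₂ : Level) : Set (lsuc (c ⊔ ℓ₁ ⊔ ℓ₂)) where
  field
    commRing : CommutativeRing c ℓ₁
  open CommutativeRing commRing public
  field
    _≤_          : Carrier → Carrier → Set ℓ₂
    isTotalOrder : IsTotalOrder _≈_ _≤_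
    +-mono-≤     : ∀ {x y} z → x ≤ y → (x + z) ≤ (y + z)
    *-nonneg     : ∀ {x y} → 0# ≤ x → 0# ≤ y → 0# ≤ (x * y)
    nontrivial   : ¬ (1# ≈ 0#)
    _⁻¹          : Carrier → Carrier
    ⁻¹-cong      : ∀ {x y} → x ≈ y → (x ⁻¹) ≈ (y ⁻¹)
    inverseʳ     : ∀ x → ¬ (x ≈ 0#) → (x * (x ⁻¹)) ≈ 1#
    sqrt         : Carrier → Carrier
    sqrt-cong    : ∀ {x y} → x ≈ y → sqrt x ≈ sqrt y
    sqrt-nonneg  : ∀ x → 0# ≤ sqrt x
    sqrt-sq      : ∀ x → 0# ≤ x → (sqrt x * sqrt x) ≈ x

module Indices {c ℓ₁ ℓ₂} (F : SqrtOrderedField c ℓ₁ ℓ₂) where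
  open SqrtOrderedField F

  ℕ→F : ℕ → Carrier
  ℕ→F zero    = 0#
  ℕ→F (suc k) = 1# + ℕ→F k

  _/_ : Carrier → Carrier → Carrier
  x / y = x * (y ⁻¹)

  -- sum of f(u,v) over the edges uv of G, each edge counted once (u < v)
  edgeSum : ∀ {n} → Graph n → (Fin n → Fin n → Carrier) → Carrier
  edgeSum {n} G f =
    foldr _+_ 0# (map (λ i → foldr _+_ 0# (map (λ j → term i j) (allFin n))) (allFin n))
    where
      term : Fin n → Fin n → Carrier
      term i j with adj G i j | toℕ i ℕ.<? toℕ j
      ... | true | Relation.Nullary.yes _ = f i j
      ... | _    | _                      = 0#

  sqrtTerm : ∀ {n} → Graph n → Fin n → Fin n → Carrier
  sqrtTerm G i j = sqrt (ℕ→F (deg G i ℕ.* deg G i ℕ.+ deg G j ℕ.* deg G j))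

  SO : ∀ {n} → Graph n → Carrier
  SO G = edgeSum G (sqrtTerm G)

  DSO : ∀ {n} → Graph n → Carrier
  DSO G = edgeSum G (λ i j → sqrtTerm G i j / ℕ→F (deg G i ℕ.+ deg G j))

-- Edge by edge, d_u + d_v lies between 2δ and 2Δ, so the summand √(d_u² + d_v²)/(d_u + d_v)
-- of DSO lies between the corresponding summands of SO/(2Δ) and SO/(2δ); summing gives the
-- bounds. Since √(d_u² + d_v²) > 0, equality of the sums forces equality on every edge,
-- i.e. d_u = d_v = Δ (resp. δ) at both ends of every edge. In a connected graph with at
-- least two vertices every vertex lies on an edge, so the graph is regular; conversely, in
-- a regular graph all the compared summands coincide.
module Submission where

open import Defs hiding (sym)
open import Level using (Level)
open import Data.Bool using (true; false)
open import Data.Empty using (⊥-elim)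
open import Data.Fin using (Fin; toℕ) renaming (zero to fzero; suc to fsuc)
open import Data.Fin.Properties using (toℕ-injective)
open import Data.List using (List; []; _∷_; foldr; map; allFin)
open import Data.List.Membership.Propositional using (_∈_; lose)
open import Data.List.Membership.Propositional.Properties using (∈-allFin)
open import Data.List.Properties using (filter-some; foldr-preservesᵇ; foldr-preservesᵒ)
open import Data.List.Relation.Unary.Any using (here; there)
import Data.List.Relation.Unary.All.Properties as All
import Data.List.Relation.Unary.Any.Properties as Any
open import Data.Nat as ℕ using (ℕ; zero; suc; _≤_; _<_; z≤n; s≤s)
  renaming (_+_ to _+ℕ_; _*_ to _*ℕ_)
open import Data.Nat.Properties as ℕ using ()
open import Data.Product using (_×_; _,_; proj₁; proj₂; ∃-syntax; Σ-syntax)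
open import Data.Sum using (_⊎_; inj₁; inj₂; [_,_])
open import Function.Bundles using (_⇔_; mk⇔)
open import Relation.Binary.Bundles using (Poset)
open import Relation.Binary.Definitions using (tri<; tri≈; tri>)
open import Relation.Binary.PropositionalEquality as ≡ using (_≡_)
open import Relation.Binary.Structures using (IsTotalOrder)
open import Relation.Nullary using (¬_; yes; no)

m≤o→n≤p→m+n≡o+p⇒m≡o : ∀ {m n o p} → m ≤ o → n ≤ p → m +ℕ n ≡ o +ℕ p → m ≡ o
m≤o→n≤p→m+n≡o+p⇒m≡o {m} {n} {o} {p} m≤o n≤p eq = ℕ.≤-antisym m≤o (ℕ.+-cancelʳ-≤ p o m o+p≤m+p)
  where
  o+p≤m+p : o +ℕ p ≤ m +ℕ p
  o+p≤m+p = ℕ.≤-trans (ℕ.≤-reflexive (≡.sym eq)) (ℕ.+-monoʳ-≤ m n≤p)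

2*n≡n+n : ∀ n → 2 *ℕ n ≡ n +ℕ n
2*n≡n+n n = ≡.cong (n +ℕ_) (ℕ.+-identityʳ n)

-- Degrees

-- edgeSum counts the edge {i, j} once, at the ordering with toℕ i < toℕ j.
UpperEdge : ∀ {n} → Graph n → Fin n → Fin n → Set
UpperEdge G i j = adj G i j ≡ true × toℕ i < toℕ j

degSum : ∀ {n} → Graph n → Fin n → Fin n → ℕ
degSum G i j = deg G i +ℕ deg G j

module _ {n} (G : Graph n) where

  adj⇒0<deg : ∀ {i j} → adj G i j ≡ true → 0 < deg G i
  adj⇒0<deg {j = j} e = filter-some _ (lose (∈-allFin j) e)

  adj⇒0<degSum : ∀ {i j} → adj G i j ≡ true → 0 < degSum G i j
  adj⇒0<degSum {i} {j} e = ℕ.≤-trans (adj⇒0<deg e) (ℕ.m≤m+n (deg G i) (deg G j))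

  adj⇒UpperEdge : ∀ {i j} → adj G i j ≡ true → UpperEdge G i j ⊎ UpperEdge G j i
  adj⇒UpperEdge {i} {j} e with ℕ.<-cmp (toℕ i) (toℕ j)
  ... | tri< i<j _ _ = inj₁ (e , i<j)
  ... | tri> _ _ j<i = inj₂ (≡.trans (Graph.sym G j i) e , j<i)
  ... | tri≈ _ i≡j _ with ≡.trans (≡.sym e) (≡.trans (≡.cong (adj G i) (≡.sym (toℕ-injective i≡j))) (irrefl G i))
  ...   | ()

module _ {m} (G : Graph (suc m)) where

  private
    degrees : List ℕ
    degrees = map (deg G) (allFin (suc m))

  deg≤maxDeg : ∀ i → deg G i ≤ maxDeg G
  deg≤maxDeg i = foldr-preservesᵒ {P = deg G i ≤_} (λ x y → [ ℕ.m≤n⇒m≤n⊔o y , ℕ.m≤n⇒m≤o⊔n x ]) 0 degrees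
    (inj₂ (Any.map⁺ (lose (∈-allFin i) ℕ.≤-refl)))

  maxDeg≤ : ∀ {k} → (∀ i → deg G i ≤ k) → maxDeg G ≤ k
  maxDeg≤ {k} bound = foldr-preservesᵇ {P = _≤ k} ℕ.⊔-lub z≤n (All.map⁺ (All.tabulate⁺ bound))

  minDeg≤deg : ∀ i → minDeg G ≤ deg G i
  minDeg≤deg i = foldr-preservesᵒ {P = _≤ deg G i} (λ x y → [ ℕ.m≤n⇒m⊓o≤n y , ℕ.m≤n⇒o⊓m≤n x ]) (deg G fzero) degrees
    (inj₂ (Any.map⁺ (lose (∈-allFin i) ℕ.≤-refl)))

  ≤minDeg : ∀ {k} → (∀ i → k ≤ deg G i) → k ≤ minDeg G
  ≤minDeg {k} bound = foldr-preservesᵇ {P = k ≤_} ℕ.⊓-glb (bound fzero) (All.map⁺ (All.tabulate⁺ bound))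

  degSum≤2*maxDeg : ∀ i j → degSum G i j ≤ 2 *ℕ maxDeg G
  degSum≤2*maxDeg i j = ℕ.≤-trans (ℕ.+-mono-≤ (deg≤maxDeg i) (deg≤maxDeg j)) (ℕ.≤-reflexive (≡.sym (2*n≡n+n (maxDeg G))))

  2*minDeg≤degSum : ∀ i j → 2 *ℕ minDeg G ≤ degSum G i j
  2*minDeg≤degSum i j = ℕ.≤-trans (ℕ.≤-reflexive (2*n≡n+n (minDeg G))) (ℕ.+-mono-≤ (minDeg≤deg i) (minDeg≤deg j))

  degSum≡2*maxDeg⇒deg≡maxDeg : ∀ {i j} → degSum G i j ≡ 2 *ℕ maxDeg G →
                                deg G i ≡ maxDeg G × deg G j ≡ maxDeg G
  degSum≡2*maxDeg⇒deg≡maxDeg {i} {j} eq =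
      m≤o→n≤p→m+n≡o+p⇒m≡o (deg≤maxDeg i) (deg≤maxDeg j) eq′
    , m≤o→n≤p→m+n≡o+p⇒m≡o (deg≤maxDeg j) (deg≤maxDeg i) (≡.trans (ℕ.+-comm (deg G j) (deg G i)) eq′)
    where
    eq′ : degSum G i j ≡ maxDeg G +ℕ maxDeg G
    eq′ = ≡.trans eq (2*n≡n+n (maxDeg G))

  degSum≡2*minDeg⇒deg≡minDeg : ∀ {i j} → degSum G i j ≡ 2 *ℕ minDeg G →
                                deg G i ≡ minDeg G × deg G j ≡ minDeg G
  degSum≡2*minDeg⇒deg≡minDeg {i} {j} eq =
      ≡.sym (m≤o→n≤p→m+n≡o+p⇒m≡o (minDeg≤deg i) (minDeg≤deg j) eq′)
    , ≡.sym (m≤o→n≤p→m+n≡o+p⇒m≡o (minDeg≤deg j) (minDeg≤deg i) (≡.trans eq′ (ℕ.+-comm (deg G i) (deg G j))))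
    where
    eq′ : minDeg G +ℕ minDeg G ≡ degSum G i j
    eq′ = ≡.trans (≡.sym (2*n≡n+n (minDeg G))) (≡.sym eq)

  Regular⇒degSum≡2*maxDeg : Regular G → ∀ i j → degSum G i j ≡ 2 *ℕ maxDeg G
  Regular⇒degSum≡2*maxDeg reg i j = ≡.trans (≡.cong₂ _+ℕ_ (deg≡maxDeg i) (deg≡maxDeg j)) (≡.sym (2*n≡n+n (maxDeg G)))
    where
    deg≡maxDeg : ∀ k → deg G k ≡ maxDeg G
    deg≡maxDeg k = ℕ.≤-antisym (deg≤maxDeg k) (maxDeg≤ (λ l → ℕ.≤-reflexive (reg l k)))

  Regular⇒degSum≡2*minDeg : Regular G → ∀ i j → degSum G i j ≡ 2 *ℕ minDeg G
  Regular⇒degSum≡2*minDeg reg i j = ≡.trans (≡.cong₂ _+ℕ_ (deg≡minDeg i) (deg≡minDeg j)) (≡.sym (2*n≡n+n (minDeg G)))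
    where
    deg≡minDeg : ∀ k → deg G k ≡ minDeg G
    deg≡minDeg k = ℕ.≤-antisym (≤minDeg (λ l → ℕ.≤-reflexive (reg k l))) (minDeg≤deg k)

module _ {m} (G : Graph (suc (suc m))) (connected : Connected G) where

  neighbour : ∀ i → ∃[ j ] adj G i j ≡ true
  neighbour fzero with connected fzero (fsuc fzero)
  ... | step {j = j} e _ = j , e
  neighbour (fsuc i) with connected (fsuc i) fzero
  ... | step {j = j} e _ = j , e

  0<minDeg : 0 < minDeg G
  0<minDeg = ≤minDeg G (λ i → adj⇒0<deg G (proj₂ (neighbour i)))

  edgewise-constant⇒Regular : ∀ {k} → (∀ {i j} → UpperEdge G i j → deg G i ≡ k × deg G j ≡ k) → Regular G
  edgewise-constant⇒Regular {k} const i j = ≡.trans (deg≡k i) (≡.sym (deg≡k j))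
    where
    deg≡k : ∀ v → deg G v ≡ k
    deg≡k v with adj⇒UpperEdge G (proj₂ (neighbour v))
    ... | inj₁ v→w = proj₁ (const v→w)
    ... | inj₂ w→v = proj₂ (const w→v)


-- Ordered fields with square roots

module OrderedFieldProperties {c ℓ₁ ℓ₂} (F : SqrtOrderedField c ℓ₁ ℓ₂) where

  open SqrtOrderedField F renaming (_≤_ to infix 4 _≤F_; +-mono-≤ to +-monoˡ-≤)
  open Indices F using (ℕ→F; _/_)
  open IsTotalOrder isTotalOrder public
    using (total; antisym) renaming (refl to ≤-refl; reflexive to ≤-reflexive; trans to ≤-trans)
  open import Algebra.Properties.Ring ring using (+-cancelˡ; +-cancelʳ; -‿distribʳ-*; -1*x≈-x; -‿involutive)
  open import Algebra.Properties.CommutativeSemigroup *-commutativeSemigroup using (x∙yz≈y∙xz; x∙yz≈yx∙z)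

  poset : Poset c ℓ₁ ℓ₂
  poset = record { isPartialOrder = IsTotalOrder.isPartialOrder isTotalOrder }

  open import Relation.Binary.Reasoning.PartialOrder poset

  +-monoʳ-≤ : ∀ {x y} z → x ≤F y → z + x ≤F z + y
  +-monoʳ-≤ {x} {y} z x≤y = begin
    z + x  ≈⟨ +-comm z x ⟩
    x + z  ≤⟨ +-monoˡ-≤ z x≤y ⟩
    y + z  ≈⟨ +-comm y z ⟩
    z + y  ∎

  +-mono-≤ : ∀ {x x′ y y′} → x ≤F x′ → y ≤F y′ → x + y ≤F x′ + y′
  +-mono-≤ {x} {x′} {y} {y′} x≤x′ y≤y′ = ≤-trans (+-monoˡ-≤ y x≤x′) (+-monoʳ-≤ x′ y≤y′)

  x≤0⇒0≤-x : ∀ {x} → x ≤F 0# → 0# ≤F - x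
  x≤0⇒0≤-x {x} x≤0 = begin
    0#       ≈⟨ -‿inverseʳ x ⟨
    x - x    ≤⟨ +-monoˡ-≤ (- x) x≤0 ⟩
    0# - x   ≈⟨ +-identityˡ (- x) ⟩
    - x      ∎

  0≤-x⇒x≤0 : ∀ {x} → 0# ≤F - x → x ≤F 0#
  0≤-x⇒x≤0 {x} 0≤-x = begin
    x        ≈⟨ +-identityˡ x ⟨
    0# + x   ≤⟨ +-monoˡ-≤ x 0≤-x ⟩
    - x + x  ≈⟨ -‿inverseˡ x ⟩
    0#       ∎

  0≤1 : 0# ≤F 1#
  0≤1 with total 0# 1#
  ... | inj₁ 0≤1 = 0≤1
  ... | inj₂ 1≤0 = begin
    0#              ≤⟨ *-nonneg 0≤-1 0≤-1 ⟩
    - 1# * - 1#     ≈⟨ -1*x≈-x (- 1#) ⟩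
    - - 1#          ≈⟨ -‿involutive 1# ⟩
    1#              ∎
    where
    0≤-1 : 0# ≤F - 1#
    0≤-1 = x≤0⇒0≤-x 1≤0

  1≰0 : ¬ (1# ≤F 0#)
  1≰0 1≤0 = nontrivial (antisym 1≤0 0≤1)

  *-monoˡ-≤ : ∀ {x y} z → 0# ≤F z → x ≤F y → z * x ≤F z * y
  *-monoˡ-≤ {x} {y} z 0≤z x≤y = begin
    z * x                     ≈⟨ +-identityˡ (z * x) ⟨
    0# + z * x                ≤⟨ +-monoˡ-≤ (z * x) (*-nonneg 0≤z 0≤y-x) ⟩
    z * (y - x) + z * x       ≈⟨ distribˡ z (y - x) x ⟨
    z * ((y - x) + x)         ≈⟨ *-cong refl y-x+x≈y ⟩
    z * y                     ∎
    where
    0≤y-x : 0# ≤F y - x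
    0≤y-x = begin
      0#      ≈⟨ -‿inverseʳ x ⟨
      x - x   ≤⟨ +-monoˡ-≤ (- x) x≤y ⟩
      y - x   ∎
    y-x+x≈y : (y - x) + x ≈ y
    y-x+x≈y = trans (+-assoc y (- x) x) (trans (+-cong refl (-‿inverseˡ x)) (+-identityʳ y))

  *-monoʳ-≤ : ∀ {x y} z → 0# ≤F z → x ≤F y → x * z ≤F y * z
  *-monoʳ-≤ {x} {y} z 0≤z x≤y = begin
    x * z  ≈⟨ *-comm x z ⟩
    z * x  ≤⟨ *-monoˡ-≤ z 0≤z x≤y ⟩
    z * y  ≈⟨ *-comm z y ⟩
    y * z  ∎

  ⁻¹-nonneg : ∀ {x} → 0# ≤F x → ¬ (x ≈ 0#) → 0# ≤F x ⁻¹
  ⁻¹-nonneg {x} 0≤x x≉0 with total 0# (x ⁻¹)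
  ... | inj₁ 0≤x⁻¹ = 0≤x⁻¹
  ... | inj₂ x⁻¹≤0 = ⊥-elim (1≰0 (0≤-x⇒x≤0 (begin
    0#              ≤⟨ *-nonneg 0≤x (x≤0⇒0≤-x x⁻¹≤0) ⟩
    x * - (x ⁻¹)    ≈⟨ -‿distribʳ-* x (x ⁻¹) ⟨
    - (x * x ⁻¹)    ≈⟨ -‿cong (inverseʳ x x≉0) ⟩
    - 1#            ∎)))

  ⁻¹-antitone : ∀ {x y} → 0# ≤F x → ¬ (x ≈ 0#) → x ≤F y → y ⁻¹ ≤F x ⁻¹
  ⁻¹-antitone {x} {y} 0≤x x≉0 x≤y = begin
    y ⁻¹                    ≈⟨ *-identityˡ (y ⁻¹) ⟨
    1# * y ⁻¹               ≈⟨ *-cong (inverseʳ x x≉0) refl ⟨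
    (x * x ⁻¹) * y ⁻¹       ≈⟨ *-assoc x (x ⁻¹) (y ⁻¹) ⟩
    x * (x ⁻¹ * y ⁻¹)       ≤⟨ *-monoʳ-≤ (x ⁻¹ * y ⁻¹) 0≤x⁻¹y⁻¹ x≤y ⟩
    y * (x ⁻¹ * y ⁻¹)       ≈⟨ x∙yz≈y∙xz y (x ⁻¹) (y ⁻¹) ⟩
    x ⁻¹ * (y * y ⁻¹)       ≈⟨ *-cong refl (inverseʳ y y≉0) ⟩
    x ⁻¹ * 1#               ≈⟨ *-identityʳ (x ⁻¹) ⟩
    x ⁻¹                    ∎
    where
    y≉0 : ¬ (y ≈ 0#)
    y≉0 y≈0 = x≉0 (antisym (≤-trans x≤y (≤-reflexive y≈0)) 0≤x)
    0≤x⁻¹y⁻¹ : 0# ≤F x ⁻¹ * y ⁻¹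
    0≤x⁻¹y⁻¹ = *-nonneg (⁻¹-nonneg 0≤x x≉0) (⁻¹-nonneg (≤-trans 0≤x x≤y) y≉0)

  *-cancelˡ : ∀ {z x y} → ¬ (z ≈ 0#) → z * x ≈ z * y → x ≈ y
  *-cancelˡ {z} {x} {y} z≉0 zx≈zy = begin-equality
    x                  ≈⟨ *-identityʳ x ⟨
    x * 1#             ≈⟨ *-cong refl (inverseʳ z z≉0) ⟨
    x * (z * z ⁻¹)     ≈⟨ x∙yz≈yx∙z x z (z ⁻¹) ⟩
    (z * x) * z ⁻¹     ≈⟨ *-cong zx≈zy refl ⟩
    (z * y) * z ⁻¹     ≈⟨ x∙yz≈yx∙z y z (z ⁻¹) ⟨
    y * (z * z ⁻¹)     ≈⟨ *-cong refl (inverseʳ z z≉0) ⟩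
    y * 1#             ≈⟨ *-identityʳ y ⟩
    y                  ∎

  ⁻¹-injective : ∀ {x y} → ¬ (x ≈ 0#) → ¬ (y ≈ 0#) → x ⁻¹ ≈ y ⁻¹ → x ≈ y
  ⁻¹-injective {x} {y} x≉0 y≉0 x⁻¹≈y⁻¹ = begin-equality
    x                  ≈⟨ *-identityʳ x ⟨
    x * 1#             ≈⟨ *-cong refl (inverseʳ y y≉0) ⟨
    x * (y * y ⁻¹)     ≈⟨ x∙yz≈y∙xz x y (y ⁻¹) ⟩
    y * (x * y ⁻¹)     ≈⟨ *-cong refl (*-cong refl x⁻¹≈y⁻¹) ⟨
    y * (x * x ⁻¹)     ≈⟨ *-cong refl (inverseʳ x x≉0) ⟩
    y * 1#             ≈⟨ *-identityʳ y ⟩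
    y                  ∎

  /-antitoneʳ : ∀ {x y} z → 0# ≤F z → 0# ≤F x → ¬ (x ≈ 0#) → x ≤F y → z / y ≤F z / x
  /-antitoneʳ z 0≤z 0≤x x≉0 x≤y = *-monoˡ-≤ z 0≤z (⁻¹-antitone 0≤x x≉0 x≤y)

  /-cancelˡ : ∀ {z x y} → ¬ (z ≈ 0#) → ¬ (x ≈ 0#) → ¬ (y ≈ 0#) → z / x ≈ z / y → x ≈ y
  /-cancelˡ z≉0 x≉0 y≉0 eq = ⁻¹-injective x≉0 y≉0 (*-cancelˡ z≉0 eq)

  sqrt≉0 : ∀ {x} → 0# ≤F x → ¬ (x ≈ 0#) → ¬ (sqrt x ≈ 0#)
  sqrt≉0 {x} 0≤x x≉0 sqrt-x≈0 = x≉0 (begin-equality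
    x                  ≈⟨ sqrt-sq x 0≤x ⟨
    sqrt x * sqrt x    ≈⟨ *-cong sqrt-x≈0 sqrt-x≈0 ⟩
    0# * 0#            ≈⟨ zeroˡ 0# ⟩
    0#                 ∎)

  +-≤-≈⇒≈ : ∀ {x x′ y y′} → x ≤F x′ → y ≤F y′ → x + y ≈ x′ + y′ → x ≈ x′ × y ≈ y′
  +-≤-≈⇒≈ {x} {x′} {y} {y′} x≤x′ y≤y′ eq = +-cancelʳ y x x′ x+y≈x′+y , +-cancelˡ x y y′ x+y≈x+y′
    where
    x+y≈x′+y : x + y ≈ x′ + y
    x+y≈x′+y = antisym (+-monoˡ-≤ y x≤x′) (begin
      x′ + y   ≤⟨ +-monoʳ-≤ x′ y≤y′ ⟩
      x′ + y′  ≈⟨ eq ⟨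
      x + y    ∎)
    x+y≈x+y′ : x + y ≈ x + y′
    x+y≈x+y′ = antisym (+-monoʳ-≤ x y≤y′) (begin
      x + y′   ≤⟨ +-monoˡ-≤ y′ x≤x′ ⟩
      x′ + y′  ≈⟨ eq ⟨
      x + y    ∎)

  ℕ→F-nonneg : ∀ k → 0# ≤F ℕ→F k
  ℕ→F-nonneg zero    = ≤-refl
  ℕ→F-nonneg (suc k) = begin
    0#           ≈⟨ +-identityʳ 0# ⟨
    0# + 0#      ≤⟨ +-mono-≤ 0≤1 (ℕ→F-nonneg k) ⟩
    1# + ℕ→F k   ∎

  ℕ→F-mono : ∀ {k l} → k ≤ l → ℕ→F k ≤F ℕ→F l
  ℕ→F-mono {l = l} z≤n = ℕ→F-nonneg l
  ℕ→F-mono (s≤s k≤l)   = +-monoʳ-≤ 1# (ℕ→F-mono k≤l)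

  ℕ→F-nonzero : ∀ {k} → 0 < k → ¬ (ℕ→F k ≈ 0#)
  ℕ→F-nonzero {suc k} _ k≈0 = 1≰0 (begin
    1#           ≈⟨ +-identityʳ 1# ⟨
    1# + 0#      ≤⟨ ℕ→F-mono {1} {suc k} (s≤s z≤n) ⟩
    1# + ℕ→F k   ≈⟨ k≈0 ⟩
    0#           ∎)

  ℕ→F-injective : ∀ {k l} → ℕ→F k ≈ ℕ→F l → k ≡ l
  ℕ→F-injective {zero}  {zero}  _   = ≡.refl
  ℕ→F-injective {zero}  {suc l} eq  = ⊥-elim (ℕ→F-nonzero {suc l} (s≤s z≤n) (sym eq))
  ℕ→F-injective {suc k} {zero}  eq  = ⊥-elim (ℕ→F-nonzero {suc k} (s≤s z≤n) eq)
  ℕ→F-injective {suc k} {suc l} eq  = ≡.cong suc (ℕ→F-injective (+-cancelˡ 1# (ℕ→F k) (ℕ→F l) eq))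

  /ℕ→F-antitone : ∀ {z k l} → 0# ≤F z → 0 < k → k ≤ l → z / ℕ→F l ≤F z / ℕ→F k
  /ℕ→F-antitone {k = k} 0≤z 0<k k≤l = /-antitoneʳ _ 0≤z (ℕ→F-nonneg k) (ℕ→F-nonzero 0<k) (ℕ→F-mono k≤l)

  /ℕ→F-cancelˡ : ∀ {z k l} → ¬ (z ≈ 0#) → 0 < k → 0 < l → z / ℕ→F k ≈ z / ℕ→F l → k ≡ l
  /ℕ→F-cancelˡ z≉0 0<k 0<l eq = ℕ→F-injective (/-cancelˡ z≉0 (ℕ→F-nonzero 0<k) (ℕ→F-nonzero 0<l) eq)

-- Sums over the edges of a graph

module EdgeSums {c ℓ₁ ℓ₂} (F : SqrtOrderedField c ℓ₁ ℓ₂) where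

  open SqrtOrderedField F renaming (_≤_ to infix 4 _≤F_) hiding (+-mono-≤)
  open Indices F using (edgeSum)
  open OrderedFieldProperties F
  open import Relation.Binary.Reasoning.PartialOrder poset

  sumOf : ∀ {A : Set} → (A → Carrier) → List A → Carrier
  sumOf h xs = foldr _+_ 0# (map h xs)

  module _ {A : Set} {h k : A → Carrier} where

    sumOf-mono : ∀ xs → (∀ x → h x ≤F k x) → sumOf h xs ≤F sumOf k xs
    sumOf-mono []       _   = ≤-refl
    sumOf-mono (x ∷ xs) h≤k = +-mono-≤ (h≤k x) (sumOf-mono xs h≤k)

    sumOf-cong : ∀ xs → (∀ x → h x ≈ k x) → sumOf h xs ≈ sumOf k xs
    sumOf-cong []       _   = refl
    sumOf-cong (x ∷ xs) h≈k = +-cong (h≈k x) (sumOf-cong xs h≈k)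

    sumOf-≤-≈⇒≈ : ∀ {xs} → (∀ x → h x ≤F k x) → sumOf h xs ≈ sumOf k xs → ∀ {x} → x ∈ xs → h x ≈ k x
    sumOf-≤-≈⇒≈ {y ∷ ys} h≤k eq (here ≡.refl) = proj₁ (+-≤-≈⇒≈ (h≤k y) (sumOf-mono ys h≤k) eq)
    sumOf-≤-≈⇒≈ {y ∷ ys} h≤k eq (there x∈ys) =
      sumOf-≤-≈⇒≈ h≤k (proj₂ (+-≤-≈⇒≈ (h≤k y) (sumOf-mono ys h≤k) eq)) x∈ys

  sumOf-*ʳ : ∀ {A : Set} (h : A → Carrier) z xs → sumOf h xs * z ≈ sumOf (λ x → h x * z) xs
  sumOf-*ʳ h z []       = zeroˡ z
  sumOf-*ʳ h z (x ∷ xs) = trans (distribʳ z (h x) (sumOf h xs)) (+-cong refl (sumOf-*ʳ h z xs))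

  module _ {n} (G : Graph n) where

    -- The summand of edgeSum is local to its definition in Defs; unifying edgeSum with a
    -- double sum recovers it under a name.
    edgeSum-as-double-sum : ∀ f → Σ[ t ∈ (Fin n → Fin n → Carrier) ]
                            edgeSum G f ≡ sumOf (λ i → sumOf (t i) (allFin n)) (allFin n)
    edgeSum-as-double-sum f = _ , ≡.refl

    edgeTerm : (Fin n → Fin n → Carrier) → Fin n → Fin n → Carrier
    edgeTerm f = proj₁ (edgeSum-as-double-sum f)

    edgeTerm-upper : ∀ f {i j} → UpperEdge G i j → edgeTerm f i j ≡ f i j
    edgeTerm-upper f {i} {j} (adj≡true , i<j) with adj G i j | adj≡true | toℕ i ℕ.<? toℕ j
    ... | true | ≡.refl | yes _  = ≡.refl
    ... | true | ≡.refl | no i≮j = ⊥-elim (i≮j i<j)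

    edgeTerm-rel : ∀ {ℓ} (R : Carrier → Carrier → Set ℓ) → R 0# 0# → ∀ {f g} →
                   (∀ {i j} → UpperEdge G i j → R (f i j) (g i j)) →
                   ∀ i j → R (edgeTerm f i j) (edgeTerm g i j)
    edgeTerm-rel R R00 related i j with adj G i j in adj≡true | toℕ i ℕ.<? toℕ j
    ... | true  | yes i<j = related (adj≡true , i<j)
    ... | true  | no _    = R00
    ... | false | _       = R00

    edgeSum-mono : ∀ {f g} → (∀ {i j} → UpperEdge G i j → f i j ≤F g i j) → edgeSum G f ≤F edgeSum G g
    edgeSum-mono f≤g =
      sumOf-mono (allFin n) (λ i → sumOf-mono (allFin n) (edgeTerm-rel _≤F_ ≤-refl f≤g i))

    edgeSum-cong : ∀ {f g} → (∀ {i j} → UpperEdge G i j → f i j ≈ g i j) → edgeSum G f ≈ edgeSum G g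
    edgeSum-cong f≈g =
      sumOf-cong (allFin n) (λ i → sumOf-cong (allFin n) (edgeTerm-rel _≈_ refl f≈g i))

    edgeSum-*ʳ : ∀ f z → edgeSum G f * z ≈ edgeSum G (λ i j → f i j * z)
    edgeSum-*ʳ f z = trans (sumOf-*ʳ _ z (allFin n)) (sumOf-cong (allFin n) (λ i →
      trans (sumOf-*ʳ _ z (allFin n))
            (sumOf-cong (allFin n) (edgeTerm-rel (λ x y → x * z ≈ y) (zeroˡ z) {f} (λ _ → refl) i))))

    edgeSum-≤-≈⇒≈ : ∀ {f g} → (∀ {i j} → UpperEdge G i j → f i j ≤F g i j) → edgeSum G f ≈ edgeSum G g →
                    ∀ {i j} → UpperEdge G i j → f i j ≈ g i j
    edgeSum-≤-≈⇒≈ {f} {g} f≤g eq {i} {j} ij = begin-equality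
      f i j            ≡⟨ edgeTerm-upper f ij ⟨
      edgeTerm f i j   ≈⟨ sumOf-≤-≈⇒≈ (edgeTerm-rel _≤F_ ≤-refl f≤g i) rows≈ (∈-allFin j) ⟩
      edgeTerm g i j   ≡⟨ edgeTerm-upper g ij ⟩
      g i j            ∎
      where
      rows≈ : sumOf (edgeTerm f i) (allFin n) ≈ sumOf (edgeTerm g i) (allFin n)
      rows≈ = sumOf-≤-≈⇒≈ (λ k → sumOf-mono (allFin n) (edgeTerm-rel _≤F_ ≤-refl f≤g k)) eq (∈-allFin i)

-- Comparing the Sombor and diminished Sombor indices

module SomborIndices {c ℓ₁ ℓ₂} (F : SqrtOrderedField c ℓ₁ ℓ₂) where

  open SqrtOrderedField F renaming (_≤_ to infix 4 _≤F_) hiding (+-mono-≤)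
  open Indices F
  open OrderedFieldProperties F
  open EdgeSums F
  open import Relation.Binary.Reasoning.PartialOrder poset

  module _ {n} (G : Graph n) where

    sqrtTerm/ : (Fin n → Fin n → ℕ) → Fin n → Fin n → Carrier
    sqrtTerm/ w i j = sqrtTerm G i j / ℕ→F (w i j)

    sqrtTerm≉0 : ∀ {i j} → adj G i j ≡ true → ¬ (sqrtTerm G i j ≈ 0#)
    sqrtTerm≉0 {i} {j} e = sqrt≉0 (ℕ→F-nonneg (deg G i *ℕ deg G i +ℕ deg G j *ℕ deg G j)) (ℕ→F-nonzero
      (ℕ.≤-trans (ℕ.*-mono-≤ (adj⇒0<deg G e) (adj⇒0<deg G e)) (ℕ.m≤m+n _ (deg G j *ℕ deg G j))))

    SO/≈edgeSum : ∀ N → SO G / ℕ→F N ≈ edgeSum G (sqrtTerm/ (λ _ _ → N))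
    SO/≈edgeSum N = edgeSum-*ʳ G (sqrtTerm G) (ℕ→F N ⁻¹)

    module _ {v w : Fin n → Fin n → ℕ} (v≤w : ∀ {i j} → UpperEdge G i j → 0 < v i j × v i j ≤ w i j) where

      private
        termwise : ∀ {i j} → UpperEdge G i j → sqrtTerm/ w i j ≤F sqrtTerm/ v i j
        termwise ij = /ℕ→F-antitone (sqrt-nonneg _) (proj₁ (v≤w ij)) (proj₂ (v≤w ij))

      edgeSum-sqrtTerm/-antitone : edgeSum G (sqrtTerm/ w) ≤F edgeSum G (sqrtTerm/ v)
      edgeSum-sqrtTerm/-antitone = edgeSum-mono G termwise

      edgeSum-sqrtTerm/-tight : edgeSum G (sqrtTerm/ w) ≈ edgeSum G (sqrtTerm/ v) →
                                ∀ {i j} → UpperEdge G i j → w i j ≡ v i j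
      edgeSum-sqrtTerm/-tight eq ij = /ℕ→F-cancelˡ (sqrtTerm≉0 (proj₁ ij))
        (ℕ.≤-trans (proj₁ (v≤w ij)) (proj₂ (v≤w ij))) (proj₁ (v≤w ij)) (edgeSum-≤-≈⇒≈ G termwise eq ij)

    module _ {N : ℕ} where

      SO/N≤DSO : (∀ {i j} → UpperEdge G i j → degSum G i j ≤ N) → SO G / ℕ→F N ≤F DSO G
      SO/N≤DSO bound = begin
        SO G / ℕ→F N                        ≈⟨ SO/≈edgeSum N ⟩
        edgeSum G (sqrtTerm/ (λ _ _ → N))   ≤⟨ edgeSum-sqrtTerm/-antitone (λ ij → adj⇒0<degSum G (proj₁ ij) , bound ij) ⟩
        DSO G                               ∎

      DSO≤SO/N : 0 < N → (∀ {i j} → UpperEdge G i j → N ≤ degSum G i j) → DSO G ≤F SO G / ℕ→F N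
      DSO≤SO/N 0<N bound = begin
        DSO G                               ≤⟨ edgeSum-sqrtTerm/-antitone (λ ij → 0<N , bound ij) ⟩
        edgeSum G (sqrtTerm/ (λ _ _ → N))   ≈⟨ SO/≈edgeSum N ⟨
        SO G / ℕ→F N                        ∎

      SO/N≈DSO⇒degSum≡N : (∀ {i j} → UpperEdge G i j → degSum G i j ≤ N) → SO G / ℕ→F N ≈ DSO G →
                          ∀ {i j} → UpperEdge G i j → degSum G i j ≡ N
      SO/N≈DSO⇒degSum≡N bound eq ij = ≡.sym (edgeSum-sqrtTerm/-tight
        (λ ij′ → adj⇒0<degSum G (proj₁ ij′) , bound ij′) (trans (sym (SO/≈edgeSum N)) eq) ij)

      DSO≈SO/N⇒degSum≡N : 0 < N → (∀ {i j} → UpperEdge G i j → N ≤ degSum G i j) → DSO G ≈ SO G / ℕ→F N →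
                          ∀ {i j} → UpperEdge G i j → degSum G i j ≡ N
      DSO≈SO/N⇒degSum≡N 0<N bound eq = edgeSum-sqrtTerm/-tight (λ ij → 0<N , bound ij) (trans eq (SO/≈edgeSum N))

      DSO≈SO/N : (∀ {i j} → UpperEdge G i j → degSum G i j ≡ N) → DSO G ≈ SO G / ℕ→F N
      DSO≈SO/N degSum≡N = begin-equality
        DSO G                               ≈⟨ edgeSum-cong G (λ ij → *-cong refl (⁻¹-cong (reflexive (≡.cong ℕ→F (degSum≡N ij))))) ⟩
        edgeSum G (sqrtTerm/ (λ _ _ → N))   ≈⟨ SO/≈edgeSum N ⟨
        SO G / ℕ→F N                        ∎

theorem3p11 : ∀ {c ℓ₁ ℓ₂ : Level} (F : SqrtOrderedField c ℓ₁ ℓ₂) →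
    let open SqrtOrderedField F renaming (_≤_ to _≤F_)
        open Indices F
    in ∀ {m : ℕ} → 1 ≤ m → (G : Graph (suc m)) → Connected G →
       ((SO G / ℕ→F (2 *ℕ maxDeg G)) ≤F DSO G)
       × (DSO G ≤F (SO G / ℕ→F (2 *ℕ minDeg G)))
       × (((SO G / ℕ→F (2 *ℕ maxDeg G)) ≈ DSO G) ⇔ Regular G)
       × ((DSO G ≈ (SO G / ℕ→F (2 *ℕ minDeg G))) ⇔ Regular G)
theorem3p11 F {suc m} _ G connected =
    SO/N≤DSO G (λ _ → degSum≤2*maxDeg G _ _)
  , DSO≤SO/N G 0<2*minDeg (λ _ → 2*minDeg≤degSum G _ _)
  , mk⇔ (λ eq → edgewise-constant⇒Regular G connected λ ij →
            degSum≡2*maxDeg⇒deg≡maxDeg G (SO/N≈DSO⇒degSum≡N G (λ _ → degSum≤2*maxDeg G _ _) eq ij))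
        (λ regular → sym (DSO≈SO/N G (λ _ → Regular⇒degSum≡2*maxDeg G regular _ _)))
  , mk⇔ (λ eq → edgewise-constant⇒Regular G connected λ ij →
            degSum≡2*minDeg⇒deg≡minDeg G (DSO≈SO/N⇒degSum≡N G 0<2*minDeg (λ _ → 2*minDeg≤degSum G _ _) eq ij))
        (λ regular → DSO≈SO/N G (λ _ → Regular⇒degSum≡2*minDeg G regular _ _))
  where
  open SqrtOrderedField F using (sym)
  open SomborIndices F
  0<2*minDeg : 0 < 2 *ℕ minDeg G
  0<2*minDeg = ℕ.≤-trans (0<minDeg G connected) (ℕ.m≤m+n _ _)
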